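{- For every permutation $\pi$ (not necessarily $132$-avoiding), $B(\pi\oplus1)=A(\pi)+\mathsf{des}(\pi)$.
   Context: For $\pi\in S_n$ (permutations of $\{1,\dots,n\}$ in one-line notation): $\mathsf{des}(\pi)=\mathrm{card}\{i<n:\pi_i>\pi_{i+1}\}$; $A(\pi)=\mathrm{card}\{(i,j):1\le i<j\le n-1,\ \pi_{j+1}<\pi_i<\pi_j\}$ (occurrences of the vincular pattern $2\text{ - }\underline{31}$); $B(\pi)=\mathrm{card}\{(i,j):1\le i<j\le n-1,\ \pi_j<\pi_i<\pi_{j+1}\}$ (occurrences of $2\text{ - }\underline{13}$). $\pi\oplus1$ is the permutation of length $n+1$ obtained by appending the entry $n+1$ to $\pi$. -}

module Defs where

open import Data.Nat using (ℕ; zero; suc; _+_; _∸_; _<?_)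
open import Data.Fin using (toℕ; fromℕ; fromℕ<)
open import Data.Fin.Permutation using (Permutation′; _⟨$⟩ʳ_; insert)
open import Data.Bool using (Bool; _∧_; if_then_else_)
open import Relation.Nullary using (yes; no)
open import Relation.Nullary.Decidable using (⌊_⌋)

-- Positions and values are
-- 0-indexed (position k here is position k+1 in the paper, value v is v+1);
-- all statistics below depend only on relative order, so this is harmless.

-- The one-line word of π as a function of the (0-indexed) position;
-- positions ≥ n (never used by the statistics) are sent to 0.
val : {n : ℕ} → Permutation′ n → ℕ → ℕ
val {n} π k with k <? n
... | yes k<n = toℕ (π ⟨$⟩ʳ fromℕ< k<n)
... | no _ = 0

_<ᵇ_ : ℕ → ℕ → Bool
a <ᵇ b = ⌊ a <? b ⌋

count : ℕ → (ℕ → Bool) → ℕ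
count zero p = 0
count (suc m) p = count m p + (if p m then 1 else 0)

countPairs : ℕ → (ℕ → ℕ → Bool) → ℕ
countPairs zero p = 0
countPairs (suc m) p = countPairs m p + count m (λ i → p i m)

des : {n : ℕ} → Permutation′ n → ℕ
des {n} π = count (n ∸ 1) (λ i → val π (suc i) <ᵇ val π i)

-- A(π) = card { (i,j) : 1 ≤ i < j ≤ n-1 , π_{j+1} < π_i < π_j }   (pattern 2-31)
A : {n : ℕ} → Permutation′ n → ℕ
A {n} π = countPairs (n ∸ 1) (λ i j → (val π (suc j) <ᵇ val π i) ∧ (val π i <ᵇ val π j))

-- B(π) = card { (i,j) : 1 ≤ i < j ≤ n-1 , π_j < π_i < π_{j+1} }   (pattern 2-13)
B : {n : ℕ} → Permutation′ n → ℕ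
B {n} π = countPairs (n ∸ 1) (λ i j → (val π j <ᵇ val π i) ∧ (val π i <ᵇ val π (suc j)))

-- π ⊕ 1 : append the new maximum n (0-indexed) at the last position n.
_⊕1 : {n : ℕ} → Permutation′ n → Permutation′ (suc n)
_⊕1 {n} π = insert (fromℕ n) (fromℕ n) π

module Submission where

-- Let x = x₀ … x_k be the one-line word of π ∈ S_{k+1}.  Appending the new
-- maximum does not change the earlier letters, so the occurrences (i , j) of
-- 2-13 in π ⊕ 1 are those of π (j < k) together with those ending in the
-- last two letters (j = k), i.e. the i < k with x_k < x_i:
--     B(π ⊕ 1) = B(π) + #{ i < k : x_i > x_k }.                  (B-⊕1)
-- The theorem then follows from a balance identity valid for every word
-- x₀ … x_m with distinct letters:
--     #2-13(x) + #{ i < m : x_i > x_m } = #2-31(x) + des(x).      (balance)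
-- It is proved by induction on m: extending the word by x_{m+1} adds, for
-- each earlier letter a = x_i, the terms [x_m < a < x_{m+1}] and
-- [x_{m+1} < a < x_m], and since a ∉ {x_m , x_{m+1}} these satisfy
--     [x_m < a < x_{m+1}] + [x_{m+1} < a] = [x_{m+1} < a < x_m] + [x_m < a],
-- while the new descent [x_{m+1} < x_m] is added on the right-hand side and
-- as the new "larger letter" term on the left.

open import Defs
open import Data.Nat using (ℕ; _+_)
open import Data.Fin.Permutation using (Permutation′)
open import Relation.Binary.PropositionalEquality using (_≡_)

open import Data.Nat using (suc; _<_; _≤_; _<?_; s≤s)
open import Data.Nat.Properties
  using (<-cmp; <-asym; <-irrefl; <-trans; ≤-refl; n<1+n; m<n⇒m<1+n; m≤n⇒m≤1+n; n≤1+n;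
         <⇒≤; +-commutativeSemigroup)
open import Algebra.Properties.CommutativeSemigroup +-commutativeSemigroup using (interchange)
open import Data.Nat.Solver using (module +-*-Solver)
open import Data.Fin using (Fin; toℕ; fromℕ; fromℕ<; punchIn; _≟_)
  renaming (zero to fzero; suc to fsuc)
open import Data.Fin.Properties using (toℕ-injective; toℕ-fromℕ<; toℕ<n; toℕ-fromℕ)
open import Data.Fin.Permutation using (_⟨$⟩ʳ_; insert-punchIn)
open import Function.Bundles using (Injection)
open import Function.Properties.Inverse using (↔⇒↣)
open import Data.Bool using (Bool; true; false; _∧_; if_then_else_)
open import Data.Bool.Properties using (∧-identityʳ)
open import Data.Product using (proj₂)
open import Relation.Nullary using (¬_; yes; no)
open import Relation.Nullary.Negation using (contradiction)
open import Relation.Nullary.Decidable using (isYes≗does; dec-true; dec-false; dec-yes)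
open import Relation.Binary using (tri<; tri≈; tri>)
open import Relation.Binary.PropositionalEquality
  using (refl; sym; trans; cong; cong₂; _≢_; module ≡-Reasoning)

open +-*-Solver using (solve; _:+_; _:=_)

[_] : Bool → ℕ
[ b ] = if b then 1 else 0

<ᵇ-true : ∀ {a b} → a < b → (a <ᵇ b) ≡ true
<ᵇ-true {a} {b} a<b = trans (isYes≗does (a <? b)) (dec-true (a <? b) a<b)

<ᵇ-false : ∀ {a b} → ¬ (a < b) → (a <ᵇ b) ≡ false
<ᵇ-false {a} {b} a≮b = trans (isYes≗does (a <? b)) (dec-false (a <? b) a≮b)

by-comparisons : ∀ {p q r s u v w z : Bool} → p ≡ u → q ≡ v → r ≡ w → s ≡ z →
  [ u ∧ v ] + [ w ] ≡ [ w ∧ z ] + [ u ] → [ p ∧ q ] + [ r ] ≡ [ r ∧ s ] + [ p ]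
by-comparisons refl refl refl refl e = e

indicator-balance : ∀ a b c → a ≢ b → a ≢ c →
  [ (b <ᵇ a) ∧ (a <ᵇ c) ] + [ c <ᵇ a ] ≡ [ (c <ᵇ a) ∧ (a <ᵇ b) ] + [ b <ᵇ a ]
indicator-balance a b c a≢b a≢c with <-cmp a b | <-cmp a c
... | tri≈ _ a≡b _ | _ = contradiction a≡b a≢b
... | _ | tri≈ _ a≡c _ = contradiction a≡c a≢c
... | tri< a<b _ _ | tri< a<c _ _ = by-comparisons (<ᵇ-false (<-asym a<b)) (<ᵇ-true a<c)  (<ᵇ-false (<-asym a<c)) (<ᵇ-true a<b) refl
... | tri< a<b _ _ | tri> _ _ c<a = by-comparisons (<ᵇ-false (<-asym a<b)) (<ᵇ-false (<-asym c<a)) (<ᵇ-true c<a)  (<ᵇ-true a<b) refl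
... | tri> _ _ b<a | tri< a<c _ _ = by-comparisons (<ᵇ-true b<a)  (<ᵇ-true a<c)  (<ᵇ-false (<-asym a<c)) (<ᵇ-false (<-asym b<a)) refl
... | tri> _ _ b<a | tri> _ _ c<a = by-comparisons (<ᵇ-true b<a)  (<ᵇ-false (<-asym c<a)) (<ᵇ-true c<a)  (<ᵇ-false (<-asym b<a)) refl

count-cong : ∀ m {p q : ℕ → Bool} → (∀ i → i < m → p i ≡ q i) → count m p ≡ count m q
count-cong 0       p≗q = refl
count-cong (suc m) p≗q =
  cong₂ _+_ (count-cong m (λ i i<m → p≗q i (m<n⇒m<1+n i<m))) (cong [_] (p≗q m (n<1+n m)))

count-balance : ∀ m {f g h k : ℕ → Bool} →
  (∀ i → i < m → [ f i ] + [ g i ] ≡ [ h i ] + [ k i ]) →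
  count m f + count m g ≡ count m h + count m k
count-balance 0 e = refl
count-balance (suc m) {f} {g} {h} {k} e = begin
  (count m f + [ f m ]) + (count m g + [ g m ])  ≡⟨ interchange (count m f) [ f m ] (count m g) [ g m ] ⟩
  (count m f + count m g) + ([ f m ] + [ g m ])  ≡⟨ cong₂ _+_ (count-balance m (λ i i<m → e i (m<n⇒m<1+n i<m)))
                                                              (e m (n<1+n m)) ⟩
  (count m h + count m k) + ([ h m ] + [ k m ])  ≡⟨ interchange (count m h) (count m k) [ h m ] [ k m ] ⟩
  (count m h + [ h m ]) + (count m k + [ k m ])  ∎
  where open ≡-Reasoning

countPairs-cong : ∀ m {p q : ℕ → ℕ → Bool} →
  (∀ i j → i < j → j < m → p i j ≡ q i j) → countPairs m p ≡ countPairs m q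
countPairs-cong 0       p≗q = refl
countPairs-cong (suc m) p≗q =
  cong₂ _+_ (countPairs-cong m (λ i j i<j j<m → p≗q i j i<j (m<n⇒m<1+n j<m)))
            (count-cong m (λ i i<m → p≗q i m i<m (n<1+n m)))

occ-2-13 occ-2-31 descents larger-than-last : (ℕ → ℕ) → ℕ → ℕ
occ-2-13 x m = countPairs m (λ i j → (x j <ᵇ x i) ∧ (x i <ᵇ x (suc j)))
occ-2-31 x m = countPairs m (λ i j → (x (suc j) <ᵇ x i) ∧ (x i <ᵇ x j))
descents x m = count m (λ i → x (suc i) <ᵇ x i)
larger-than-last x m = count m (λ i → x m <ᵇ x i)

Distinct : (ℕ → ℕ) → ℕ → Set
Distinct x m = ∀ {i j} → i < j → j ≤ m → x i ≢ x j

occ-2-13-cong : ∀ m {x y : ℕ → ℕ} → (∀ i → i ≤ m → x i ≡ y i) → occ-2-13 x m ≡ occ-2-13 y m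
occ-2-13-cong m x≗y = countPairs-cong m λ i j i<j j<m →
  cong₂ _∧_ (cong₂ _<ᵇ_ (x≗y j (<⇒≤ j<m)) (x≗y i (<⇒≤ (<-trans i<j j<m))))
            (cong₂ _<ᵇ_ (x≗y i (<⇒≤ (<-trans i<j j<m))) (x≗y (suc j) j<m))

balance : ∀ x m → Distinct x m →
  occ-2-13 x m + larger-than-last x m ≡ occ-2-31 x m + descents x m
balance x 0 _ = refl
balance x (suc m) distinct = begin
  (U + cu) + (L′ + t)  ≡⟨ solve 4 (λ U cu L′ t → (U :+ cu) :+ (L′ :+ t) := U :+ (cu :+ L′) :+ t) refl U cu L′ t ⟩
  U + (cu + L′) + t    ≡⟨ cong (λ z → U + z + t) new-letter ⟩
  U + (cd + L) + t     ≡⟨ solve 4 (λ U cd L t → U :+ (cd :+ L) :+ t := (U :+ L) :+ (cd :+ t)) refl U cd L t ⟩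
  (U + L) + (cd + t)   ≡⟨ cong (_+ (cd + t)) (balance x m (λ i<j j≤m → distinct i<j (m≤n⇒m≤1+n j≤m))) ⟩
  (D + E) + (cd + t)   ≡⟨ solve 4 (λ D E cd t → (D :+ E) :+ (cd :+ t) := (D :+ cd) :+ (E :+ t)) refl D E cd t ⟩
  (D + cd) + (E + t)   ∎
  where
  open ≡-Reasoning
  U = occ-2-13 x m
  D = occ-2-31 x m
  E = descents x m
  L = larger-than-last x m
  L′ = count m (λ i → x (suc m) <ᵇ x i)
  cu = count m (λ i → (x m <ᵇ x i) ∧ (x i <ᵇ x (suc m)))
  cd = count m (λ i → (x (suc m) <ᵇ x i) ∧ (x i <ᵇ x m))
  t = [ x (suc m) <ᵇ x m ]
  new-letter : cu + L′ ≡ cd + L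
  new-letter = count-balance m λ i i<m →
    indicator-balance (x i) (x m) (x (suc m))
      (distinct i<m (n≤1+n m)) (distinct (m<n⇒m<1+n i<m) ≤-refl)

val-lookup : ∀ {n} (π : Permutation′ n) {i} (i<n : i < n) → val π i ≡ toℕ (π ⟨$⟩ʳ fromℕ< i<n)
val-lookup {n} π {i} i<n with i <? n
... | yes _   = refl
... | no i≮n = contradiction i<n i≮n

val-bound : ∀ {n} (π : Permutation′ n) {i} → i < n → val π i < n
val-bound π i<n rewrite val-lookup π i<n = toℕ<n _

val-distinct : ∀ {k} (π : Permutation′ (suc k)) → Distinct (val π) k
val-distinct π {i} {j} i<j j≤k vi≡vj = <-irrefl i≡j i<j
  where
  i<n = <-trans i<j (s≤s j≤k)
  j<n = s≤s j≤k
  same-point : fromℕ< i<n ≡ fromℕ< j<n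
  same-point = Injection.injective (↔⇒↣ π)
    (toℕ-injective (trans (sym (val-lookup π i<n)) (trans vi≡vj (val-lookup π j<n))))
  i≡j : i ≡ j
  i≡j = trans (sym (toℕ-fromℕ< i<n)) (trans (cong toℕ same-point) (toℕ-fromℕ< j<n))

toℕ-punchIn-fromℕ : ∀ n (k : Fin n) → toℕ (punchIn (fromℕ n) k) ≡ toℕ k
toℕ-punchIn-fromℕ (suc n) fzero    = refl
toℕ-punchIn-fromℕ (suc n) (fsuc k) = cong suc (toℕ-punchIn-fromℕ n k)

val-⊕1-prefix : ∀ {n} (π : Permutation′ n) {j} → j < n → val (π ⊕1) j ≡ val π j
val-⊕1-prefix {n} π {j} j<n = begin
  val (π ⊕1) j                                            ≡⟨ val-lookup (π ⊕1) (m<n⇒m<1+n j<n) ⟩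
  toℕ (π ⊕1 ⟨$⟩ʳ fromℕ< (m<n⇒m<1+n j<n))                  ≡⟨ cong (λ k → toℕ (π ⊕1 ⟨$⟩ʳ k)) position ⟩
  toℕ (π ⊕1 ⟨$⟩ʳ punchIn (fromℕ n) (fromℕ< j<n))          ≡⟨ cong toℕ (insert-punchIn (fromℕ n) (fromℕ n) π _) ⟩
  toℕ (punchIn (fromℕ n) (π ⟨$⟩ʳ fromℕ< j<n))             ≡⟨ toℕ-punchIn-fromℕ n _ ⟩
  toℕ (π ⟨$⟩ʳ fromℕ< j<n)                                 ≡⟨ sym (val-lookup π j<n) ⟩
  val π j                                                 ∎
  where
  open ≡-Reasoning
  position : fromℕ< (m<n⇒m<1+n j<n) ≡ punchIn (fromℕ n) (fromℕ< j<n)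
  position = toℕ-injective (trans (toℕ-fromℕ< _)
    (sym (trans (toℕ-punchIn-fromℕ n _) (toℕ-fromℕ< j<n))))

val-⊕1-last : ∀ {n} (π : Permutation′ n) → val (π ⊕1) n ≡ n
val-⊕1-last {n} π = begin
  val (π ⊕1) n                      ≡⟨ val-lookup (π ⊕1) (n<1+n n) ⟩
  toℕ (π ⊕1 ⟨$⟩ʳ fromℕ< (n<1+n n))  ≡⟨ cong (λ k → toℕ (π ⊕1 ⟨$⟩ʳ k)) position ⟩
  toℕ (π ⊕1 ⟨$⟩ʳ fromℕ n)           ≡⟨ cong toℕ fixes-top ⟩
  toℕ (fromℕ n)                     ≡⟨ toℕ-fromℕ n ⟩
  n                                 ∎
  where
  open ≡-Reasoning
  position : fromℕ< (n<1+n n) ≡ fromℕ n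
  position = toℕ-injective (trans (toℕ-fromℕ< _) (sym (toℕ-fromℕ n)))
  fixes-top : π ⊕1 ⟨$⟩ʳ fromℕ n ≡ fromℕ n
  fixes-top rewrite proj₂ (dec-yes (fromℕ n ≟ fromℕ n) refl) = refl

B-⊕1 : ∀ k (π : Permutation′ (suc k)) →
  B (π ⊕1) ≡ occ-2-13 (val π) k + larger-than-last (val π) k
B-⊕1 k π = cong₂ _+_
  (occ-2-13-cong k (λ i i≤k → val-⊕1-prefix π (s≤s i≤k)))
  (count-cong k λ i i<k → begin
    (σ k <ᵇ σ i) ∧ (σ i <ᵇ σ (suc k))  ≡⟨ cong₂ _∧_ (cong₂ _<ᵇ_ (σ≗x (n<1+n k)) (σ≗x (m<n⇒m<1+n i<k)))
                                                    (cong₂ _<ᵇ_ (σ≗x (m<n⇒m<1+n i<k)) (val-⊕1-last π)) ⟩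
    (x k <ᵇ x i) ∧ (x i <ᵇ suc k)      ≡⟨ cong ((x k <ᵇ x i) ∧_) (<ᵇ-true (val-bound π (m<n⇒m<1+n i<k))) ⟩
    (x k <ᵇ x i) ∧ true                ≡⟨ ∧-identityʳ _ ⟩
    x k <ᵇ x i                         ∎)
  where
  open ≡-Reasoning
  x σ : ℕ → ℕ
  x = val π
  σ = val (π ⊕1)
  σ≗x : ∀ {j} → j < suc k → σ j ≡ x j
  σ≗x = val-⊕1-prefix π

lemma1 : (n : ℕ) (π : Permutation′ n) → B (π ⊕1) ≡ A π + des π
lemma1 0       π = refl
lemma1 (suc k) π = begin
  B (π ⊕1)                                           ≡⟨ B-⊕1 k π ⟩
  occ-2-13 (val π) k + larger-than-last (val π) k    ≡⟨ balance (val π) k (val-distinct π) ⟩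
  occ-2-31 (val π) k + descents (val π) k            ∎
  where open ≡-Reasoning
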